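{- Let $(n_0,d_0)\in\{(16,12),(20,15),(32,24),(36,27),(40,30),(48,36),(52,39),(56,42),(64,48)\}$. If there is no quaternary Hermitian LCD $[n_0,3,d_0]$ code $C$ with $d(C^{\perp_H})\ge2$, then for every positive integer $s$ there is no quaternary Hermitian LCD $[21s+n_0,3,16s+d_0]$ code $D$ with $d(D^{\perp_H})\ge2$.
   Context: $\mathbb{F}_4=\{0,1,\omega,\omega^2\}$ with $\omega^2=\omega+1$, $\overline{x}=x^2$. A quaternary $[n,k,d]$ code is a $k$-dimensional subspace of $\mathbb{F}_4^n$ with minimum nonzero Hamming weight $d(C)=d$. The Hermitian dual is $C^{\perp_H}=\{x : \sum_i x_i\overline{y_i}=0\ \forall y\in C\}$, and $C$ is Hermitian LCD if $C\cap C^{\perp_H}=\{0\}$. -}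

module Defs where

open import Data.Nat using (ℕ; zero; suc; _≤_)
open import Data.Fin using (Fin)
import Data.Fin as Fin
open import Data.Product using (Σ; _×_; _,_)
open import Relation.Binary.PropositionalEquality using (_≡_)
open import Relation.Nullary using (¬_)

data F4 : Set where
  𝟘 𝟙 ω ω² : F4

infixl 6 _⊕_
infixl 7 _⊗_

_⊕_ : F4 → F4 → F4
𝟘 ⊕ y = y
x ⊕ 𝟘 = x
𝟙 ⊕ 𝟙 = 𝟘
𝟙 ⊕ ω = ω²
𝟙 ⊕ ω² = ω
ω ⊕ 𝟙 = ω²
ω ⊕ ω = 𝟘
ω ⊕ ω² = 𝟙
ω² ⊕ 𝟙 = ω
ω² ⊕ ω = 𝟙
ω² ⊕ ω² = 𝟘

_⊗_ : F4 → F4 → F4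
𝟘 ⊗ y = 𝟘
𝟙 ⊗ y = y
ω ⊗ 𝟘 = 𝟘
ω ⊗ 𝟙 = ω
ω ⊗ ω = ω²
ω ⊗ ω² = 𝟙
ω² ⊗ 𝟘 = 𝟘
ω² ⊗ 𝟙 = ω²
ω² ⊗ ω = 𝟙
ω² ⊗ ω² = ω

conj : F4 → F4
conj x = x ⊗ x

Vec4 : ℕ → Set
Vec4 n = Fin n → F4

wt : ∀ {n} → Vec4 n → ℕ
wt {zero} x = 0
wt {suc n} x with x Fin.zero
... | 𝟘 = wt {n} (λ i → x (Fin.suc i))
... | _ = suc (wt {n} (λ i → x (Fin.suc i)))

Σ4 : ∀ {n} → (Fin n → F4) → F4
Σ4 {zero} f = 𝟘
Σ4 {suc n} f = f Fin.zero ⊕ Σ4 {n} (λ i → f (Fin.suc i))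

⟨_,_⟩H : ∀ {n} → Vec4 n → Vec4 n → F4
⟨ x , y ⟩H = Σ4 (λ i → x i ⊗ conj (y i))

IsZero : ∀ {n} → Vec4 n → Set
IsZero x = ∀ i → x i ≡ 𝟘

-- A quaternary linear [n,k] code, given by a k×n generator matrix whose
-- rows are linearly independent (so the code, their span, has dimension k).
record LinearCode (n k : ℕ) : Set where
  field
    gen   : Fin k → Vec4 n
    indep : ∀ (m : Fin k → F4) → IsZero (λ j → Σ4 (λ r → m r ⊗ gen r j)) → ∀ r → m r ≡ 𝟘
open LinearCode public

_∈C_ : ∀ {n k} → Vec4 n → LinearCode n k → Set
_∈C_ {n} {k} x C = Σ (Fin k → F4) λ m → ∀ j → x j ≡ Σ4 (λ r → m r ⊗ gen C r j)

_∈⊥H_ : ∀ {n k} → Vec4 n → LinearCode n k → Set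
_∈⊥H_ {n} x C = ∀ (y : Vec4 n) → y ∈C C → ⟨ x , y ⟩H ≡ 𝟘

HermitianLCD : ∀ {n k} → LinearCode n k → Set
HermitianLCD {n} C = ∀ (x : Vec4 n) → x ∈C C → x ∈⊥H C → IsZero x

MinDist : ∀ {n k} → LinearCode n k → ℕ → Set
MinDist {n} C d =
  (∀ (x : Vec4 n) → x ∈C C → ¬ IsZero x → d ≤ wt x) ×
  Σ (Vec4 n) (λ x → x ∈C C × ¬ IsZero x × wt x ≡ d)

DualDistAtLeast : ∀ {n k} → LinearCode n k → ℕ → Set
DualDistAtLeast {n} C e = ∀ (x : Vec4 n) → x ∈⊥H C → ¬ IsZero x → e ≤ wt x

ExistsHLCD : ℕ → ℕ → ℕ → Set
ExistsHLCD n k d = Σ (LinearCode n k) λ C → HermitianLCD C × MinDist C d × DualDistAtLeast C 2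

-- Let C be a Hermitian LCD [N, 3, D] code over F4, N = 21 + n, D = 16 + d, whose
-- Hermitian dual has minimum weight at least 2 (no zero column), with 3n ≤ 4d,
-- i.e. 3N < 4D. For a point p of PG(2,4), the 16 lines avoiding p give 16
-- nonzero codewords with at most N − D zeros each, while every column not
-- proportional to p is a zero of four of them; since 4N > 16(N − D), some column
-- is proportional to p. Deleting one such column for each of the 21 points
-- deletes a copy of the simplex code, whose nonzero codewords all have weight 16
-- and which is Hermitian self-orthogonal: weights drop by exactly 16 and the Gram
-- form of the code is unchanged, so the remaining n columns give a Hermitian LCD
-- [n, 3, d] code, again without zero columns. As 3n₀ = 4d₀ for every listed
-- pair, s such steps lead from length 21s + n₀ down to n₀.

module Submission where

open import Defs
open import Data.Nat using (ℕ; _+_; _*_; _≤_)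
open import Data.Product using (_,_; _×_)
open import Data.List using (List; _∷_; [])
open import Data.List.Membership.Propositional using (_∈_)
open import Relation.Nullary using (¬_)

open import Algebra.Structures using (IsCommutativeMonoid)
open import Data.Empty using (⊥-elim)
open import Data.Fin using (Fin; zero; suc)
import Data.Fin.Properties as Fin
open import Data.List using (_++_; concatMap; map; length; lookup; tabulate; filter; foldr)
open import Data.List.Membership.Propositional using (find)
open import Data.List.Membership.Propositional.Properties using (∈-∃++; ∈-filter⁻; ∈-lookup)
open import Data.List.Properties
  using (map-cong; map-∘; map-++; map-tabulate; tabulate-cong; tabulate-lookup; length-map; length-++; length-tabulate)
open import Data.List.Relation.Binary.Permutation.Propositional using (_↭_; ↭⇒↭ₛ; prep; ↭-refl; ↭-trans)
open import Data.List.Relation.Binary.Permutation.Propositional.Properties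
  using (shift; ↭-length; All-resp-↭; Any-resp-↭)
import Data.List.Relation.Binary.Permutation.Propositional.Properties as ↭
open import Data.List.Relation.Binary.Permutation.Setoid.Properties using (foldr-commMonoid)
open import Data.List.Relation.Unary.All as All using (All; []; _∷_)
open import Data.List.Relation.Unary.All.Properties using (¬Any⇒All¬; tabulate⁺; ++⁻ʳ)
open import Data.List.Relation.Unary.AllPairs using ([]; _∷_)
open import Data.List.Relation.Unary.Any as Any using (Any; here; there)
open import Data.List.Relation.Unary.Unique.Propositional using (Unique)
import Data.List.Relation.Unary.Unique.DecPropositional as UniqueDec
open import Data.Nat using (zero; suc; _<_; z≤n; s≤s)
open import Data.Nat.ListAction using (sum)
open import Data.Nat.ListAction.Properties using (sum-++; sum-↭)
import Data.Nat.Properties as ℕ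
open import Algebra.Properties.CommutativeSemigroup ℕ.+-commutativeSemigroup
  using () renaming (interchange to +-interchange)
open import Data.Nat.Tactic.RingSolver using (solve-∀)
open import Data.Product using (∃-syntax; ∃₂; proj₁; proj₂)
import Data.Product.Properties as ×
open import Function using (_∘_)
open import Relation.Binary.Definitions using (DecidableEquality)
open import Relation.Binary.PropositionalEquality
  using (_≡_; _≢_; refl; sym; trans; cong; cong₂; subst; subst₂; setoid; module ≡-Reasoning)
open import Relation.Binary.PropositionalEquality.Algebra using (isMagma)
open import Algebra.Structures.Biased (_≡_ {A = F4}) using (isCommutativeMonoidˡ)
open import Relation.Nullary.Decidable
  using (Dec; yes; no; map′; decidable-stable; from-yes; _×-dec_; _→-dec_; ¬?)

-- Arithmetic in F4

toℕ : F4 → ℕ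
toℕ 𝟘 = 0
toℕ 𝟙 = 1
toℕ ω = 2
toℕ ω² = 3

fromℕ : ℕ → F4
fromℕ 0 = 𝟘
fromℕ 1 = 𝟙
fromℕ 2 = ω
fromℕ _ = ω²

fromℕ-toℕ : ∀ x → fromℕ (toℕ x) ≡ x
fromℕ-toℕ 𝟘 = refl
fromℕ-toℕ 𝟙 = refl
fromℕ-toℕ ω = refl
fromℕ-toℕ ω² = refl

infix 4 _≟_
_≟_ : DecidableEquality F4
x ≟ y = map′ toℕ-injective (cong toℕ) (toℕ x ℕ.≟ toℕ y)
  where
  toℕ-injective : toℕ x ≡ toℕ y → x ≡ y
  toℕ-injective e = trans (sym (fromℕ-toℕ x)) (trans (cong fromℕ e) (fromℕ-toℕ y))

∀? : {P : F4 → Set} → (∀ x → Dec (P x)) → Dec (∀ x → P x)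
∀? P? = map′ (λ (p₀ , p₁ , p₂ , p₃) → λ { 𝟘 → p₀ ; 𝟙 → p₁ ; ω → p₂ ; ω² → p₃ })
             (λ p → p 𝟘 , p 𝟙 , p ω , p ω²)
             (P? 𝟘 ×-dec P? 𝟙 ×-dec P? ω ×-dec P? ω²)

⊕-comm : ∀ x y → x ⊕ y ≡ y ⊕ x
⊕-comm = from-yes (∀? λ x → ∀? λ y → x ⊕ y ≟ y ⊕ x)

⊕-assoc : ∀ x y z → (x ⊕ y) ⊕ z ≡ x ⊕ (y ⊕ z)
⊕-assoc = from-yes (∀? λ x → ∀? λ y → ∀? λ z → (x ⊕ y) ⊕ z ≟ x ⊕ (y ⊕ z))

⊕-identityʳ : ∀ x → x ⊕ 𝟘 ≡ x
⊕-identityʳ x = ⊕-comm x 𝟘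

⊗-zeroʳ : ∀ x → x ⊗ 𝟘 ≡ 𝟘
⊗-zeroʳ = from-yes (∀? λ x → x ⊗ 𝟘 ≟ 𝟘)

⊗-distribˡ-⊕ : ∀ x y z → x ⊗ (y ⊕ z) ≡ x ⊗ y ⊕ x ⊗ z
⊗-distribˡ-⊕ = from-yes (∀? λ x → ∀? λ y → ∀? λ z → x ⊗ (y ⊕ z) ≟ x ⊗ y ⊕ x ⊗ z)

⊗-lcomm : ∀ x y z → x ⊗ (y ⊗ z) ≡ y ⊗ (x ⊗ z)
⊗-lcomm = from-yes (∀? λ x → ∀? λ y → ∀? λ z → x ⊗ (y ⊗ z) ≟ y ⊗ (x ⊗ z))

⊗-conj-nonzero : ∀ x y → x ≢ 𝟘 → y ≢ 𝟘 → x ⊗ conj y ≢ 𝟘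
⊗-conj-nonzero = from-yes (∀? λ x → ∀? λ y →
  ¬? (x ≟ 𝟘) →-dec ¬? (y ≟ 𝟘) →-dec ¬? (x ⊗ conj y ≟ 𝟘))

⊕-isCommutativeMonoid : IsCommutativeMonoid _≡_ _⊕_ 𝟘
⊕-isCommutativeMonoid = isCommutativeMonoidˡ record
  { isSemigroup = record { isMagma = isMagma _⊕_ ; assoc = ⊕-assoc }
  ; identityˡ = λ _ → refl
  ; comm = ⊕-comm
  }

wt₁ : F4 → ℕ
wt₁ 𝟘 = 0
wt₁ _ = 1

zero₁ : F4 → ℕ
zero₁ 𝟘 = 1
zero₁ _ = 0

zero₁+wt₁ : ∀ x → zero₁ x + wt₁ x ≡ 1
zero₁+wt₁ = from-yes (∀? λ x → zero₁ x + wt₁ x ℕ.≟ 1)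

wt₁≤1 : ∀ x → wt₁ x ≤ 1
wt₁≤1 = from-yes (∀? λ x → wt₁ x ℕ.≤? 1)

wt₁-nonzero : ∀ {x} → x ≢ 𝟘 → wt₁ x ≡ 1
wt₁-nonzero {x} = from-yes (∀? λ x → ¬? (x ≟ 𝟘) →-dec wt₁ x ℕ.≟ 1) x

wt₁-scale : ∀ a x → a ≢ 𝟘 → wt₁ (a ⊗ x) ≡ wt₁ x
wt₁-scale = from-yes (∀? λ a → ∀? λ x → ¬? (a ≟ 𝟘) →-dec wt₁ (a ⊗ x) ℕ.≟ wt₁ x)

⊗-conj-scale : ∀ a x y → a ≢ 𝟘 → (a ⊗ x) ⊗ conj (a ⊗ y) ≡ x ⊗ conj y
⊗-conj-scale = from-yes (∀? λ a → ∀? λ x → ∀? λ y →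
  ¬? (a ≟ 𝟘) →-dec (a ⊗ x) ⊗ conj (a ⊗ y) ≟ x ⊗ conj y)

Σ⊕ : List F4 → F4
Σ⊕ = foldr _⊕_ 𝟘

Σ⊕-++ : ∀ xs ys → Σ⊕ (xs ++ ys) ≡ Σ⊕ xs ⊕ Σ⊕ ys
Σ⊕-++ [] ys = refl
Σ⊕-++ (x ∷ xs) ys = trans (cong (x ⊕_) (Σ⊕-++ xs ys)) (sym (⊕-assoc x _ _))

Σ⊕-↭ : ∀ {xs ys} → xs ↭ ys → Σ⊕ xs ≡ Σ⊕ ys
Σ⊕-↭ p = foldr-commMonoid (setoid F4) ⊕-isCommutativeMonoid (↭⇒↭ₛ p)

sum-map-+ : ∀ {A : Set} (f g : A → ℕ) xs → sum (map (λ x → f x + g x) xs) ≡ sum (map f xs) + sum (map g xs)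
sum-map-+ f g [] = refl
sum-map-+ f g (x ∷ xs) = trans (cong (f x + g x +_) (sum-map-+ f g xs)) (+-interchange (f x) (g x) _ _)

sum-map-const : ∀ {A : Set} k (xs : List A) → sum (map (λ _ → k) xs) ≡ length xs * k
sum-map-const k [] = refl
sum-map-const k (x ∷ xs) = cong (k +_) (sum-map-const k xs)

sum-map-mono : ∀ {A : Set} {f g : A → ℕ} {xs} → All (λ x → f x ≤ g x) xs → sum (map f xs) ≤ sum (map g xs)
sum-map-mono [] = z≤n
sum-map-mono (le ∷ les) = ℕ.+-mono-≤ le (sum-map-mono les)

sum-map-swap : ∀ {A B : Set} (f : A → B → ℕ) xs ys →
  sum (map (λ x → sum (map (f x) ys)) xs) ≡ sum (map (λ y → sum (map (λ x → f x y) xs)) ys)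
sum-map-swap f [] ys = sym (trans (sum-map-const 0 ys) (ℕ.*-zeroʳ (length ys)))
sum-map-swap f (x ∷ xs) ys =
  trans (cong (sum (map (f x) ys) +_) (sum-map-swap f xs ys)) (sym (sum-map-+ (f x) _ ys))

Σ4-cong : ∀ {n} {f g : Fin n → F4} → (∀ i → f i ≡ g i) → Σ4 f ≡ Σ4 g
Σ4-cong {zero} _ = refl
Σ4-cong {suc n} f≗g = cong₂ _⊕_ (f≗g zero) (Σ4-cong (f≗g ∘ suc))

Σ4-zero : ∀ {n} {f : Fin n → F4} → (∀ i → f i ≡ 𝟘) → Σ4 f ≡ 𝟘
Σ4-zero {zero} _ = refl
Σ4-zero {suc n} f≡𝟘 = cong₂ _⊕_ (f≡𝟘 zero) (Σ4-zero (f≡𝟘 ∘ suc))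

Σ4-single : ∀ {n} {f : Fin n → F4} j → (∀ i → i ≢ j → f i ≡ 𝟘) → Σ4 f ≡ f j
Σ4-single {suc n} {f} zero off =
  trans (cong (f zero ⊕_) (Σ4-zero (λ i → off (suc i) λ ()))) (⊕-identityʳ (f zero))
Σ4-single {suc n} (suc j) off =
  cong₂ _⊕_ (off zero λ ()) (Σ4-single j (λ i i≢j → off (suc i) (i≢j ∘ Fin.suc-injective)))

Σ4-⊗-distribˡ : ∀ {n} a (f : Fin n → F4) → a ⊗ Σ4 f ≡ Σ4 (λ i → a ⊗ f i)
Σ4-⊗-distribˡ {zero} a f = ⊗-zeroʳ a
Σ4-⊗-distribˡ {suc n} a f = trans (⊗-distribˡ-⊕ a _ _) (cong (a ⊗ f zero ⊕_) (Σ4-⊗-distribˡ a (f ∘ suc)))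

Σ4-tabulate : ∀ {n} (f : Fin n → F4) → Σ4 f ≡ Σ⊕ (tabulate f)
Σ4-tabulate {zero} f = refl
Σ4-tabulate {suc n} f = cong (f zero ⊕_) (Σ4-tabulate (f ∘ suc))

⟨⟩H-cong : ∀ {n} {x x′ y y′ : Vec4 n} → (∀ i → x i ≡ x′ i) → (∀ i → y i ≡ y′ i) →
  ⟨ x , y ⟩H ≡ ⟨ x′ , y′ ⟩H
⟨⟩H-cong x≗x′ y≗y′ = Σ4-cong (λ i → cong₂ (λ a b → a ⊗ conj b) (x≗x′ i) (y≗y′ i))

wt-suc : ∀ {n} (x : Vec4 (suc n)) → wt x ≡ wt₁ (x zero) + wt (x ∘ suc)
wt-suc x with x zero
... | 𝟘 = refl
... | 𝟙 = refl
... | ω = refl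
... | ω² = refl

wt-tabulate : ∀ {n} (x : Vec4 n) → wt x ≡ sum (map wt₁ (tabulate x))
wt-tabulate {zero} x = refl
wt-tabulate {suc n} x = trans (wt-suc x) (cong (wt₁ (x zero) +_) (wt-tabulate (x ∘ suc)))

wt-cong : ∀ {n} {x y : Vec4 n} → (∀ i → x i ≡ y i) → wt x ≡ wt y
wt-cong {x = x} {y} x≗y =
  trans (wt-tabulate x) (trans (cong (sum ∘ map wt₁) (tabulate-cong x≗y)) (sym (wt-tabulate y)))

wt-zero : ∀ {n} (x : Vec4 n) → IsZero x → wt x ≡ 0
wt-zero {zero} x _ = refl
wt-zero {suc n} x x≡𝟘 =
  trans (wt-suc x) (cong₂ _+_ (cong wt₁ (x≡𝟘 zero)) (wt-zero (x ∘ suc) (x≡𝟘 ∘ suc)))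

wt-single : ∀ {n} (x : Vec4 n) j → (∀ i → i ≢ j → x i ≡ 𝟘) → wt x ≤ 1
wt-single x zero off
  rewrite wt-suc x | wt-zero (x ∘ suc) (λ i → off (suc i) λ ()) | ℕ.+-identityʳ (wt₁ (x zero)) =
  wt₁≤1 (x zero)
wt-single x (suc j) off rewrite wt-suc x | off zero (λ ()) =
  wt-single (x ∘ suc) j (λ i i≢j → off (suc i) (i≢j ∘ Fin.suc-injective))

wt₁≤wt : ∀ {n} (x : Vec4 n) i → wt₁ (x i) ≤ wt x
wt₁≤wt x zero rewrite wt-suc x = ℕ.m≤m+n _ _
wt₁≤wt x (suc i) rewrite wt-suc x = ℕ.≤-trans (wt₁≤wt (x ∘ suc) i) (ℕ.m≤n+m _ _)

wt₁+wt₁≤wt : ∀ {n} (x : Vec4 n) {i j} → i ≢ j → wt₁ (x i) + wt₁ (x j) ≤ wt x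
wt₁+wt₁≤wt x {zero} {zero} i≢j = ⊥-elim (i≢j refl)
wt₁+wt₁≤wt x {zero} {suc j} _ rewrite wt-suc x = ℕ.+-monoʳ-≤ _ (wt₁≤wt (x ∘ suc) j)
wt₁+wt₁≤wt x {suc i} {zero} _ rewrite wt-suc x | ℕ.+-comm (wt₁ (x (suc i))) (wt₁ (x zero)) =
  ℕ.+-monoʳ-≤ _ (wt₁≤wt (x ∘ suc) i)
wt₁+wt₁≤wt x {suc i} {suc j} i≢j rewrite wt-suc x =
  ℕ.≤-trans (wt₁+wt₁≤wt (x ∘ suc) (i≢j ∘ cong suc)) (ℕ.m≤n+m _ _)

wt≤1⇒single : ∀ {n} (x : Vec4 n) {j} → wt x ≤ 1 → x j ≢ 𝟘 → ∀ i → i ≢ j → x i ≡ 𝟘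
wt≤1⇒single x {j} wt≤1 xj≢𝟘 i i≢j with x i ≟ 𝟘
... | yes xi≡𝟘 = xi≡𝟘
... | no xi≢𝟘 = ⊥-elim (ℕ.<-irrefl refl (ℕ.≤-trans two≤wt wt≤1))
  where
  two≤wt : 2 ≤ wt x
  two≤wt =
    subst₂ (λ a b → a + b ≤ wt x) (wt₁-nonzero xi≢𝟘) (wt₁-nonzero xj≢𝟘) (wt₁+wt₁≤wt x i≢j)

-- Dual distance and zero columns

δ : ∀ {n} → Fin n → Vec4 n
δ j i with i Fin.≟ j
... | yes _ = 𝟙
... | no _ = 𝟘

δ-diag : ∀ {n} (j : Fin n) → δ j j ≡ 𝟙
δ-diag j with j Fin.≟ j
... | yes _ = refl
... | no j≢j = ⊥-elim (j≢j refl)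

δ-off : ∀ {n} {i j : Fin n} → i ≢ j → δ j i ≡ 𝟘
δ-off {i = i} {j} i≢j with i Fin.≟ j
... | yes i≡j = ⊥-elim (i≢j i≡j)
... | no _ = refl

Σ4-δ : ∀ {n} (j : Fin n) (f : Vec4 n) → Σ4 (λ i → δ j i ⊗ f i) ≡ f j
Σ4-δ j f = trans (Σ4-single j (λ i i≢j → cong (_⊗ f i) (δ-off i≢j))) (cong (_⊗ f j) (δ-diag j))

column : ∀ {n k} → LinearCode n k → Fin n → Vec4 k
column C j r = gen C r j

codeword : ∀ {n k} → LinearCode n k → Vec4 k → Vec4 n
codeword C m j = Σ4 (λ r → m r ⊗ gen C r j)

codeword-∈C : ∀ {n k} (C : LinearCode n k) m → codeword C m ∈C C
codeword-∈C C m = m , λ _ → refl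

codeword-zero : ∀ {n k} (C : LinearCode n k) {m} → IsZero m → IsZero (codeword C m)
codeword-zero C m≡𝟘 j = Σ4-zero (λ r → cong (_⊗ gen C r j) (m≡𝟘 r))

IsZero? : ∀ {n} (x : Vec4 n) → Dec (IsZero x)
IsZero? x = Fin.all? (λ i → x i ≟ 𝟘)

dualDist≥2⇒nonzeroColumns : ∀ {n k} (C : LinearCode n k) → DualDistAtLeast C 2 → ∀ j → ¬ IsZero (column C j)
dualDist≥2⇒nonzeroColumns C dd j column≡𝟘 =
  ℕ.<-irrefl refl (ℕ.≤-trans (dd (δ j) δ∈⊥H δ≢𝟘) (wt-single (δ j) j (λ i → δ-off)))
  where
  δ∈⊥H : δ j ∈⊥H C
  δ∈⊥H y (m , y≗) = trans (Σ4-δ j (conj ∘ y)) (cong conj (trans (y≗ j) (Σ4-zero λ r →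
    trans (cong (m r ⊗_) (column≡𝟘 r)) (⊗-zeroʳ (m r)))))
  δ≢𝟘 : ¬ IsZero (δ j)
  δ≢𝟘 δ≡𝟘 with trans (sym (δ-diag j)) (δ≡𝟘 j)
  ... | ()

weight≤1∉dual : ∀ {n k} (C : LinearCode n k) {x : Vec4 n} {j r} →
  wt x ≤ 1 → x j ≢ 𝟘 → gen C r j ≢ 𝟘 → ¬ x ∈⊥H C
weight≤1∉dual {n} C {x} {j} {r} wt≤1 xj≢𝟘 grj≢𝟘 x∈⊥H =
  ⊗-conj-nonzero (x j) (gen C r j) xj≢𝟘 grj≢𝟘 (begin
  x j ⊗ conj (gen C r j)   ≡⟨ cong (λ v → x j ⊗ conj v) (Σ4-δ r (column C j)) ⟨
  x j ⊗ conj (y j)         ≡⟨ Σ4-single j off ⟨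
  ⟨ x , y ⟩H               ≡⟨ x∈⊥H y (codeword-∈C C (δ r)) ⟩
  𝟘                        ∎)
  where
  open ≡-Reasoning
  y : Vec4 n
  y = codeword C (δ r)
  off : ∀ i → i ≢ j → x i ⊗ conj (y i) ≡ 𝟘
  off i i≢j = cong (_⊗ conj (y i)) (wt≤1⇒single x wt≤1 xj≢𝟘 i i≢j)

nonzeroColumns⇒dualDist≥2 : ∀ {n k} (C : LinearCode n k) → (∀ j → ¬ IsZero (column C j)) → DualDistAtLeast C 2
nonzeroColumns⇒dualDist≥2 {n} {k} C columns≢𝟘 x x∈⊥H x≢𝟘
  with j , xj≢𝟘 ← Fin.¬∀⟶∃¬ n _ (λ i → x i ≟ 𝟘) x≢𝟘
  with r , grj≢𝟘 ← Fin.¬∀⟶∃¬ k _ (λ r → gen C r j ≟ 𝟘) (columns≢𝟘 j)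
  = ℕ.≰⇒> (λ wt≤1 → weight≤1∉dual C wt≤1 xj≢𝟘 grj≢𝟘 x∈⊥H)

-- Vectors in F4³ and the projective plane PG(2,4)

F4³ : Set
F4³ = F4 × F4 × F4

0³ : F4³
0³ = 𝟘 , 𝟘 , 𝟘

toVec4 : F4³ → Vec4 3
toVec4 (a , _ , _) zero = a
toVec4 (_ , b , _) (suc zero) = b
toVec4 (_ , _ , c) (suc (suc zero)) = c

fromVec4 : Vec4 3 → F4³
fromVec4 v = v zero , v (suc zero) , v (suc (suc zero))

fromVec4≡0³⇒IsZero : ∀ v → fromVec4 v ≡ 0³ → IsZero v
fromVec4≡0³⇒IsZero v e zero = cong proj₁ e
fromVec4≡0³⇒IsZero v e (suc zero) = cong (proj₁ ∘ proj₂) e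
fromVec4≡0³⇒IsZero v e (suc (suc zero)) = cong (proj₂ ∘ proj₂) e

IsZero-toVec4⇒≡0³ : ∀ c → IsZero (toVec4 c) → c ≡ 0³
IsZero-toVec4⇒≡0³ c c≡𝟘 =
  cong₂ _,_ (c≡𝟘 zero) (cong₂ _,_ (c≡𝟘 (suc zero)) (c≡𝟘 (suc (suc zero))))

infix 4 _≟³_
_≟³_ : DecidableEquality F4³
_≟³_ = ×.≡-dec _≟_ (×.≡-dec _≟_ _≟_)

∀³? : {P : F4³ → Set} → (∀ c → Dec (P c)) → Dec (∀ c → P c)
∀³? P? = map′ (λ p (a , b , c) → p a b c) (λ p a b c → p (a , b , c))
               (∀? λ a → ∀? λ b → ∀? λ c → P? (a , b , c))

infix 8 _·_
_·_ : Vec4 3 → F4³ → F4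
m · c = Σ4 (λ r → m r ⊗ toVec4 c r)

·-zeroˡ : ∀ {m} c → IsZero m → m · c ≡ 𝟘
·-zeroˡ c m≡𝟘 = Σ4-zero (λ r → cong (_⊗ toVec4 c r) (m≡𝟘 r))

scale : F4 → F4³ → F4³
scale a (x , y , z) = a ⊗ x , a ⊗ y , a ⊗ z

toVec4-scale : ∀ a c r → toVec4 (scale a c) r ≡ a ⊗ toVec4 c r
toVec4-scale a c zero = refl
toVec4-scale a c (suc zero) = refl
toVec4-scale a c (suc (suc zero)) = refl

·-scale : ∀ m a c → m · scale a c ≡ a ⊗ (m · c)
·-scale m a c = begin
  m · scale a c
    ≡⟨ Σ4-cong (λ r → trans (cong (m r ⊗_) (toVec4-scale a c r)) (⊗-lcomm (m r) a _)) ⟩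
  Σ4 (λ r → a ⊗ (m r ⊗ toVec4 c r))
    ≡⟨ Σ4-⊗-distribˡ a (λ r → m r ⊗ toVec4 c r) ⟨
  a ⊗ (m · c) ∎
  where open ≡-Reasoning

inv : F4 → F4
inv 𝟘 = 𝟘
inv 𝟙 = 𝟙
inv ω = ω²
inv ω² = ω

-- The first nonzero coordinate; the junk value 𝟙 for 0³ makes normalize 0³ = 0³.
lead : F4³ → F4
lead (𝟘 , 𝟘 , 𝟘) = 𝟙
lead (𝟘 , 𝟘 , z) = z
lead (𝟘 , y , _) = y
lead (x , _ , _) = x

normalize : F4³ → F4³
normalize c = scale (inv (lead c)) c

lead-nonzero : ∀ c → lead c ≢ 𝟘
lead-nonzero = from-yes (∀³? λ c → ¬? (lead c ≟ 𝟘))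

scale-lead-normalize : ∀ c → scale (lead c) (normalize c) ≡ c
scale-lead-normalize = from-yes (∀³? λ c → scale (lead c) (normalize c) ≟³ c)

wt₁-·-normalize : ∀ m c → wt₁ (m · normalize c) ≡ wt₁ (m · c)
wt₁-·-normalize m c = begin
  wt₁ (m · normalize c)                   ≡⟨ wt₁-scale (lead c) _ (lead-nonzero c) ⟨
  wt₁ (lead c ⊗ (m · normalize c))        ≡⟨ cong wt₁ (·-scale m (lead c) (normalize c)) ⟨
  wt₁ (m · scale (lead c) (normalize c))  ≡⟨ cong (λ c′ → wt₁ (m · c′)) (scale-lead-normalize c) ⟩
  wt₁ (m · c)                        ∎
  where open ≡-Reasoning

⊗-conj-·-normalize : ∀ m m′ c → (m · normalize c) ⊗ conj (m′ · normalize c) ≡ (m · c) ⊗ conj (m′ · c)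
⊗-conj-·-normalize m m′ c = begin
  (m · normalize c) ⊗ conj (m′ · normalize c)
    ≡⟨ ⊗-conj-scale (lead c) _ _ (lead-nonzero c) ⟨
  (lead c ⊗ (m · normalize c)) ⊗ conj (lead c ⊗ (m′ · normalize c))
    ≡⟨ cong₂ (λ a b → a ⊗ conj b) (·-scale m (lead c) (normalize c)) (·-scale m′ (lead c) (normalize c)) ⟨
  (m · scale (lead c) (normalize c)) ⊗ conj (m′ · scale (lead c) (normalize c))
    ≡⟨ cong (λ c′ → (m · c′) ⊗ conj (m′ · c′)) (scale-lead-normalize c) ⟩
  (m · c) ⊗ conj (m′ · c) ∎
  where open ≡-Reasoning

weight : List F4³ → Vec4 3 → ℕ
weight L m = sum (map (λ c → wt₁ (m · c)) L)

zeros : List F4³ → Vec4 3 → ℕ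
zeros L m = sum (map (λ c → zero₁ (m · c)) L)

gram : List F4³ → Vec4 3 → Vec4 3 → F4
gram L m m′ = Σ⊕ (map (λ c → (m · c) ⊗ conj (m′ · c)) L)

F4s : List F4
F4s = 𝟘 ∷ 𝟙 ∷ ω ∷ ω² ∷ []

-- One representative of each of the 21 points of PG(2,4).
points : List F4³
points =
  concatMap (λ a → map (λ b → 𝟙 , a , b) F4s) F4s ++ map (λ b → 𝟘 , 𝟙 , b) F4s ++ (𝟘 , 𝟘 , 𝟙) ∷ []

points-unique : Unique points
points-unique = from-yes (UniqueDec.unique? _≟³_ points)

simplex-weight : ∀ u → u ≢ 0³ → weight points (toVec4 u) ≡ 16
simplex-weight = from-yes (∀³? λ u → ¬? (u ≟³ 0³) →-dec weight points (toVec4 u) ℕ.≟ 16)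

simplex-gram : ∀ u u′ → gram points (toVec4 u) (toVec4 u′) ≡ 𝟘
simplex-gram = from-yes (∀³? λ u → ∀³? λ u′ → gram points (toVec4 u) (toVec4 u′) ≟ 𝟘)

linesAvoiding : F4³ → List F4³
linesAvoiding p = filter (λ u → ¬? (toVec4 u · p ≟ 𝟘)) points

incidences : List F4³ → F4³ → ℕ
incidences S c = sum (map (λ u → zero₁ (toVec4 u · c)) S)

linesAvoiding-length : All (λ p → length (linesAvoiding p) ≡ 16) points
linesAvoiding-length = from-yes (All.all? (λ p → length (linesAvoiding p) ℕ.≟ 16) points)

-- Of the five lines through a point q ≠ p only the line pq meets p.
incidences-linesAvoiding :
  All (λ p → ∀ c → c ≢ 0³ → normalize c ≢ p → 4 ≤ incidences (linesAvoiding p) c) points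
incidences-linesAvoiding = from-yes (All.all? (λ p → ∀³? λ c →
  ¬? (c ≟³ 0³) →-dec ¬? (normalize c ≟³ p) →-dec 4 ℕ.≤? incidences (linesAvoiding p) c) points)

-- Codes given by lists of columns

zeros+weight : ∀ L m → zeros L m + weight L m ≡ length L
zeros+weight L m = begin
  zeros L m + weight L m
    ≡⟨ sum-map-+ (λ c → zero₁ (m · c)) (λ c → wt₁ (m · c)) L ⟨
  sum (map (λ c → zero₁ (m · c) + wt₁ (m · c)) L)
    ≡⟨ cong sum (map-cong (λ c → zero₁+wt₁ (m · c)) L) ⟩
  sum (map (λ _ → 1) L)
    ≡⟨ sum-map-const 1 L ⟩
  length L * 1
    ≡⟨ ℕ.*-identityʳ (length L) ⟩
  length L ∎
  where open ≡-Reasoning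

weight-↭-++ : ∀ {L} S R → L ↭ S ++ R → ∀ m → weight L m ≡ weight S m + weight R m
weight-↭-++ {L} S R L↭ m = begin
  sum (map f L)             ≡⟨ sum-↭ (↭.map⁺ f L↭) ⟩
  sum (map f (S ++ R))      ≡⟨ cong sum (map-++ f S R) ⟩
  sum (map f S ++ map f R)  ≡⟨ sum-++ (map f S) (map f R) ⟩
  weight S m + weight R m   ∎
  where
  open ≡-Reasoning
  f : F4³ → ℕ
  f c = wt₁ (m · c)

gram-↭-++ : ∀ {L} S R → L ↭ S ++ R → ∀ m m′ → gram L m m′ ≡ gram S m m′ ⊕ gram R m m′
gram-↭-++ {L} S R L↭ m m′ = begin
  Σ⊕ (map f L)               ≡⟨ Σ⊕-↭ (↭.map⁺ f L↭) ⟩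
  Σ⊕ (map f (S ++ R))        ≡⟨ cong Σ⊕ (map-++ f S R) ⟩
  Σ⊕ (map f S ++ map f R)    ≡⟨ Σ⊕-++ (map f S) (map f R) ⟩
  gram S m m′ ⊕ gram R m m′  ∎
  where
  open ≡-Reasoning
  f : F4³ → F4
  f c = (m · c) ⊗ conj (m′ · c)

weight-map-normalize : ∀ S m → weight (map normalize S) m ≡ weight S m
weight-map-normalize S m = trans (cong sum (sym (map-∘ S))) (cong sum (map-cong (wt₁-·-normalize m) S))

gram-map-normalize : ∀ S m m′ → gram (map normalize S) m m′ ≡ gram S m m′
gram-map-normalize S m m′ = trans (cong Σ⊕ (sym (map-∘ S))) (cong Σ⊕ (map-cong (⊗-conj-·-normalize m m′) S))

wt-columns : ∀ {n} (G : Fin n → F4³) m → wt (λ j → m · G j) ≡ weight (tabulate G) m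
wt-columns G m = trans (wt-tabulate (λ j → m · G j))
  (cong sum (trans (map-tabulate (λ j → m · G j) wt₁) (sym (map-tabulate G _))))

⟨⟩H-columns : ∀ {n} (G : Fin n → F4³) m m′ →
  ⟨ (λ j → m · G j) , (λ j → m′ · G j) ⟩H ≡ gram (tabulate G) m m′
⟨⟩H-columns G m m′ =
  trans (Σ4-tabulate (λ j → (m · G j) ⊗ conj (m′ · G j))) (cong Σ⊕ (sym (map-tabulate G _)))

record GeneratesHLCD (L : List F4³) (d : ℕ) : Set where
  field
    nonzero-columns    : All (_≢ 0³) L
    weight-≥           : ∀ m → ¬ IsZero m → d ≤ weight L m
    weight-attained    : ∃[ m ] ¬ IsZero m × weight L m ≡ d
    gram-nondegenerate : ∀ m → (∀ m′ → gram L m m′ ≡ 𝟘) → IsZero m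

columns : ∀ {n} → LinearCode n 3 → List F4³
columns C = tabulate (fromVec4 ∘ column C)

ExistsHLCD⇒GeneratesHLCD : ∀ {n d} → ExistsHLCD n 3 d → ∃[ L ] length L ≡ n × GeneratesHLCD L d
ExistsHLCD⇒GeneratesHLCD {d = d} (C , lcd , (dist-≥ , x , (m , x≗) , x≢𝟘 , wtx≡d) , dd) =
  columns C , length-tabulate _ , record
    { nonzero-columns = tabulate⁺ λ j e → dualDist≥2⇒nonzeroColumns C dd j (fromVec4≡0³⇒IsZero _ e)
    ; weight-≥ = λ m m≢𝟘 → subst (d ≤_) (wt-codeword m)
        (dist-≥ (codeword C m) (codeword-∈C C m) (λ z → m≢𝟘 (indep C m z)))
    ; weight-attained = m , (λ m≡𝟘 → x≢𝟘 (λ j → trans (x≗ j) (codeword-zero C m≡𝟘 j)))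
                          , trans (sym (wt-codeword m)) (trans (wt-cong (sym ∘ x≗)) wtx≡d)
    ; gram-nondegenerate = λ m orth → indep C m (lcd (codeword C m) (codeword-∈C C m) λ y (m′ , y≗) →
        trans (⟨⟩H-cong {x = codeword C m} (λ _ → refl) y≗)
              (trans (⟨⟩H-columns (fromVec4 ∘ column C) m m′) (orth m′)))
    }
  where
  wt-codeword : ∀ m → wt (codeword C m) ≡ weight (columns C) m
  wt-codeword = wt-columns (fromVec4 ∘ column C)

columnCode : (R : List F4³) → (∀ m → IsZero (λ j → m · lookup R j) → IsZero m) → LinearCode (length R) 3
columnCode R indep = record { gen = λ r j → toVec4 (lookup R j) r ; indep = indep }

GeneratesHLCD⇒ExistsHLCD : ∀ {R n d} → length R ≡ n → 1 ≤ d → GeneratesHLCD R d → ExistsHLCD n 3 d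
GeneratesHLCD⇒ExistsHLCD {R} {d = d} refl 1≤d G = D , lcd , (dist-≥ , witness) , dd
  where
  open GeneratesHLCD G
  wt-codeword : ∀ m → wt (λ j → m · lookup R j) ≡ weight R m
  wt-codeword m = trans (wt-columns (lookup R) m) (cong (λ L → weight L m) (tabulate-lookup R))
  gram-codeword : ∀ m m′ → ⟨ (λ j → m · lookup R j) , (λ j → m′ · lookup R j) ⟩H ≡ gram R m m′
  gram-codeword m m′ = trans (⟨⟩H-columns (lookup R) m m′) (cong (λ L → gram L m m′) (tabulate-lookup R))
  nonzero-codeword : ∀ m → ¬ IsZero m → ¬ IsZero (λ j → m · lookup R j)
  nonzero-codeword m m≢𝟘 z = ℕ.<-irrefl refl (ℕ.≤-trans 1≤d
    (ℕ.≤-trans (weight-≥ m m≢𝟘) (ℕ.≤-reflexive (trans (sym (wt-codeword m)) (wt-zero _ z)))))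
  D : LinearCode (length R) 3
  D = columnCode R λ m z → decidable-stable (IsZero? m) (λ m≢𝟘 → nonzero-codeword m m≢𝟘 z)
  lcd : HermitianLCD D
  lcd x (m , x≗) x∈⊥H j = trans (x≗ j) (·-zeroˡ (lookup R j) (gram-nondegenerate m λ m′ →
    trans (sym (gram-codeword m m′)) (trans (⟨⟩H-cong {y = codeword D m′} (sym ∘ x≗) (λ _ → refl))
                                            (x∈⊥H (codeword D m′) (codeword-∈C D m′)))))
  dist-≥ : ∀ x → x ∈C D → ¬ IsZero x → d ≤ wt x
  dist-≥ x (m , x≗) x≢𝟘 = subst (d ≤_) (trans (sym (wt-codeword m)) (wt-cong (sym ∘ x≗)))
    (weight-≥ m λ m≡𝟘 → x≢𝟘 λ j → trans (x≗ j) (·-zeroˡ (lookup R j) m≡𝟘))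
  witness : ∃[ x ] x ∈C D × ¬ IsZero x × wt x ≡ d
  witness = let m , m≢𝟘 , weight≡d = weight-attained in
    codeword D m , codeword-∈C D m , nonzero-codeword m m≢𝟘 , trans (wt-codeword m) weight≡d
  dd : DualDistAtLeast D 2
  dd = nonzeroColumns⇒dualDist≥2 D λ j z →
    All.lookup nonzero-columns (∈-lookup j) (IsZero-toVec4⇒≡0³ (lookup R j) z)

-- Removing a simplex code

simplex-block : ∀ {S} → map normalize S ≡ points →
  (∀ m → ¬ IsZero m → weight S m ≡ 16) × (∀ m m′ → gram S m m′ ≡ 𝟘)
simplex-block {S} normS≡points =
  (λ m m≢𝟘 → trans (sym (weight-map-normalize S m)) (trans (cong (λ P → weight P m) normS≡points)
    (simplex-weight (fromVec4 m) (m≢𝟘 ∘ fromVec4≡0³⇒IsZero m)))) ,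
  (λ m m′ → trans (sym (gram-map-normalize S m m′)) (trans (cong (λ P → gram P m m′) normS≡points)
    (simplex-gram (fromVec4 m) (fromVec4 m′))))

puncture : ∀ {L S R d} → L ↭ S ++ R → map normalize S ≡ points → GeneratesHLCD L (16 + d) → GeneratesHLCD R d
puncture {L} {S} {R} {d} L↭ normS≡points G = record
  { nonzero-columns = ++⁻ʳ S (All-resp-↭ L↭ nonzero-columns)
  ; weight-≥ = λ m m≢𝟘 → ℕ.+-cancelˡ-≤ 16 d _ (subst (16 + d ≤_) (weight-drops m m≢𝟘) (weight-≥ m m≢𝟘))
  ; weight-attained = let m , m≢𝟘 , weight≡ = weight-attained in
      m , m≢𝟘 , ℕ.+-cancelˡ-≡ 16 _ d (trans (sym (weight-drops m m≢𝟘)) weight≡)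
  ; gram-nondegenerate = λ m orth → gram-nondegenerate m λ m′ → trans (gram-kept m m′) (orth m′)
  }
  where
  open GeneratesHLCD G
  weight-drops : ∀ m → ¬ IsZero m → weight L m ≡ 16 + weight R m
  weight-drops m m≢𝟘 =
    trans (weight-↭-++ S R L↭ m) (cong (_+ weight R m) (proj₁ (simplex-block normS≡points) m m≢𝟘))
  gram-kept : ∀ m m′ → gram L m m′ ≡ gram R m m′
  gram-kept m m′ =
    trans (gram-↭-++ S R L↭ m m′) (cong (_⊕ gram R m m′) (proj₂ (simplex-block normS≡points) m m′))

counting-bound : ∀ N D Z → 4 * N ≤ Z → Z + 16 * D ≤ 16 * N → ¬ 3 * N < 4 * D
counting-bound N D Z 4N≤Z Z+16D≤16N 3N<4D = ℕ.<-irrefl refl (begin-strict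
  16 * N                      <⟨ ℕ.m<m+n (16 * N) (s≤s z≤n) ⟩
  16 * N + 4                  ≡⟨ identity₁ N ⟩
  4 * N + 4 * suc (3 * N)     ≤⟨ ℕ.+-monoʳ-≤ (4 * N) (ℕ.*-monoʳ-≤ 4 3N<4D) ⟩
  4 * N + 4 * (4 * D)         ≡⟨ cong (4 * N +_) (identity₂ D) ⟩
  4 * N + 16 * D              ≤⟨ ℕ.+-monoˡ-≤ (16 * D) 4N≤Z ⟩
  Z + 16 * D                  ≤⟨ Z+16D≤16N ⟩
  16 * N                      ∎)
  where
  open ℕ.≤-Reasoning
  identity₁ : ∀ N → 16 * N + 4 ≡ 4 * N + 4 * suc (3 * N)
  identity₁ = solve-∀
  identity₂ : ∀ D → 4 * (4 * D) ≡ 16 * D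
  identity₂ = solve-∀

points-occur : ∀ {L D} → 3 * length L < 4 * D → GeneratesHLCD L D →
  All (λ p → Any (λ c → normalize c ≡ p) L) points
points-occur {L} {D} 3N<4D G = All.tabulate occurs
  where
  open GeneratesHLCD G
  occurs : ∀ {p} → p ∈ points → Any (λ c → normalize c ≡ p) L
  occurs {p} p∈ with Any.any? (λ c → normalize c ≟³ p) L
  ... | yes p-occurs = p-occurs
  ... | no p-missing = ⊥-elim (counting-bound (length L) D _ by-columns by-lines 3N<4D)
    where
    S : List F4³
    S = linesAvoiding p
    |S|≡16 : length S ≡ 16
    |S|≡16 = All.lookup linesAvoiding-length p∈
    by-columns : 4 * length L ≤ sum (map (incidences S) L)
    by-columns = subst (_≤ sum (map (incidences S) L)) (trans (sum-map-const 4 L) (ℕ.*-comm (length L) 4))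
      (sum-map-mono (All.zipWith
        (λ {c} (c≢0³ , normc≢p) → All.lookup incidences-linesAvoiding p∈ c c≢0³ normc≢p)
        (nonzero-columns , ¬Any⇒All¬ L p-missing)))
    zeros+D≤N : ∀ {u} → u ∈ S → zeros L (toVec4 u) + D ≤ length L
    zeros+D≤N {u} u∈S = subst (zeros L (toVec4 u) + D ≤_) (zeros+weight L (toVec4 u))
      (ℕ.+-monoʳ-≤ _ (weight-≥ (toVec4 u) λ u≡𝟘 →
        proj₂ (∈-filter⁻ (λ u → ¬? (toVec4 u · p ≟ 𝟘)) {xs = points} u∈S) (·-zeroˡ {toVec4 u} p u≡𝟘)))
    by-lines : sum (map (incidences S) L) + 16 * D ≤ 16 * length L
    by-lines = subst₂ _≤_
      (trans (sum-map-+ (zeros L ∘ toVec4) (λ _ → D) S)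
             (cong₂ _+_ (sym (sum-map-swap (λ c u → zero₁ (toVec4 u · c)) L S))
                        (trans (sum-map-const D S) (cong (_* D) |S|≡16))))
      (trans (sum-map-const (length L) S) (cong (_* length L) |S|≡16))
      (sum-map-mono (All.tabulate zeros+D≤N))

Any⇒↭-∷ : ∀ {A : Set} {P : A → Set} {L : List A} → Any P L → ∃[ c ] P c × ∃[ L′ ] L ↭ c ∷ L′
Any⇒↭-∷ P-hit with c , c∈L , Pc ← find P-hit with ys , zs , refl ← ∈-∃++ c∈L =
  c , Pc , ys ++ zs , shift c ys zs

Any-↭-∷⁻ : ∀ {A : Set} {Q : A → Set} {L L′ c} → L ↭ c ∷ L′ → ¬ Q c → Any Q L → Any Q L′
Any-↭-∷⁻ L↭ ¬Qc Q-hit with Any-resp-↭ L↭ Q-hit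
... | here Qc = ⊥-elim (¬Qc Qc)
... | there Q-hit′ = Q-hit′

↭-preimages : ∀ {A B : Set} (f : A → B) {P : List B} {L : List A} → Unique P →
  All (λ p → Any (λ c → f c ≡ p) L) P → ∃₂ λ S R → L ↭ S ++ R × map f S ≡ P
↭-preimages f {L = L} [] [] = [] , L , ↭-refl , refl
↭-preimages f (p∉P ∷ P-unique) (p-hit ∷ P-hit)
  with c , fc≡p , L′ , L↭ ← Any⇒↭-∷ p-hit
  with S , R , L′↭ , fS≡P ← ↭-preimages f P-unique
         (All.zipWith (λ (p≢q , q-hit) → Any-↭-∷⁻ L↭ (λ fc≡q → p≢q (trans (sym fc≡p) fc≡q)) q-hit)
                      (p∉P , P-hit))
  = c ∷ S , R , ↭-trans L↭ (prep c L′↭) , cong₂ _∷_ fc≡p fS≡P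

ratio-bound : ∀ {N n d} → N ≡ 21 + n → 3 * n ≤ 4 * d → 3 * N < 4 * (16 + d)
ratio-bound {n = n} {d} refl 3n≤4d = subst₂ _≤_ (identity₁ n) (identity₂ d) (ℕ.+-monoʳ-≤ 64 3n≤4d)
  where
  identity₁ : ∀ n → 64 + 3 * n ≡ suc (3 * (21 + n))
  identity₁ = solve-∀
  identity₂ : ∀ d → 64 + 4 * d ≡ 4 * (16 + d)
  identity₂ = solve-∀

length-punctured : ∀ {L S R n} → L ↭ S ++ R → map normalize S ≡ points → length L ≡ 21 + n → length R ≡ n
length-punctured {L} {S} {R} {n} L↭ normS≡points |L|≡21+n = ℕ.+-cancelˡ-≡ 21 _ _ (begin
  21 + length R        ≡⟨ cong (_+ length R) (trans (sym (length-map normalize S)) (cong length normS≡points)) ⟨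
  length S + length R  ≡⟨ length-++ S ⟨
  length (S ++ R)      ≡⟨ ↭-length L↭ ⟨
  length L             ≡⟨ |L|≡21+n ⟩
  21 + n               ∎)
  where open ≡-Reasoning

reduce : ∀ {n d} → 3 * n ≤ 4 * d → 1 ≤ d → ExistsHLCD (21 + n) 3 (16 + d) → ExistsHLCD n 3 d
reduce {n} {d} 3n≤4d 1≤d E = from-columns (ExistsHLCD⇒GeneratesHLCD E)
  where
  from-columns : (∃[ L ] length L ≡ 21 + n × GeneratesHLCD L (16 + d)) → ExistsHLCD n 3 d
  from-columns (L , |L|≡21+n , G) =
    remove-simplex (↭-preimages normalize points-unique (points-occur (ratio-bound |L|≡21+n 3n≤4d) G))
    where
    remove-simplex : (∃₂ λ S R → L ↭ S ++ R × map normalize S ≡ points) → ExistsHLCD n 3 d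
    remove-simplex (S , R , L↭ , normS≡points) = GeneratesHLCD⇒ExistsHLCD
      (length-punctured L↭ normS≡points |L|≡21+n) 1≤d (puncture L↭ normS≡points G)

scaled-ratio : ∀ s {n₀ d₀} → 3 * n₀ ≡ 4 * d₀ → 3 * (21 * s + n₀) ≤ 4 * (16 * s + d₀)
scaled-ratio s {n₀} {d₀} 3n₀≡4d₀ = begin
  3 * (21 * s + n₀)  ≡⟨ identity₁ s n₀ ⟩
  63 * s + 3 * n₀    ≡⟨ cong (63 * s +_) 3n₀≡4d₀ ⟩
  63 * s + 4 * d₀    ≤⟨ ℕ.+-monoˡ-≤ (4 * d₀) (ℕ.*-monoˡ-≤ s (ℕ.n≤1+n 63)) ⟩
  64 * s + 4 * d₀    ≡⟨ identity₂ s d₀ ⟩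
  4 * (16 * s + d₀)  ∎
  where
  open ℕ.≤-Reasoning
  identity₁ : ∀ s n₀ → 3 * (21 * s + n₀) ≡ 63 * s + 3 * n₀
  identity₁ = solve-∀
  identity₂ : ∀ s d₀ → 64 * s + 4 * d₀ ≡ 4 * (16 * s + d₀)
  identity₂ = solve-∀

lemma5p5 : (n₀ d₀ : ℕ)
    → (n₀ , d₀) ∈ ((16 , 12) ∷ (20 , 15) ∷ (32 , 24) ∷ (36 , 27) ∷ (40 , 30) ∷ (48 , 36) ∷ (52 , 39) ∷ (56 , 42) ∷ (64 , 48) ∷ [])
    → ¬ ExistsHLCD n₀ 3 d₀
    → (s : ℕ) → 1 ≤ s → ¬ ExistsHLCD (21 * s + n₀) 3 (16 * s + d₀)
lemma5p5 n₀ d₀ n₀d₀∈ ¬E₀ s _ = descend s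
  where
  listed : 3 * n₀ ≡ 4 * d₀ × 1 ≤ d₀
  listed = All.lookup (from-yes (All.all? (λ (n , d) → (3 * n ℕ.≟ 4 * d) ×-dec (1 ℕ.≤? d))
    ((16 , 12) ∷ (20 , 15) ∷ (32 , 24) ∷ (36 , 27) ∷ (40 , 30) ∷ (48 , 36) ∷ (52 , 39) ∷ (56 , 42) ∷ (64 , 48) ∷ []))) n₀d₀∈
  shift-suc : ∀ c s x → c * suc s + x ≡ c + (c * s + x)
  shift-suc = solve-∀
  descend : ∀ s → ¬ ExistsHLCD (21 * s + n₀) 3 (16 * s + d₀)
  descend zero = ¬E₀
  descend (suc s) E = descend s (reduce (scaled-ratio s (proj₁ listed))
    (ℕ.≤-trans (proj₂ listed) (ℕ.m≤n+m d₀ (16 * s)))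
    (subst₂ (λ n d → ExistsHLCD n 3 d) (shift-suc 21 s n₀) (shift-suc 16 s d₀) E))
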